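{- Let $\mathcal{D}=(\mathcal{P},\mathcal{B})$ be a nontrivial $2$-$(v,k,\lambda)$ design admitting a flag-transitive, point-imprimitive group of automorphisms. Then $k\leq 2\lambda^2(\lambda+1)$.
   Context: A $2$-$(v,k,\lambda)$ design has $v$ points and blocks that are $k$-subsets such that every pair of distinct points lies in exactly $\lambda$ blocks; nontrivial means $2<k<v$. Flag-transitive means transitive on incident point-block pairs; point-imprimitive means preserving a partition of the point set other than the partition into singletons and the one-part partition. -}

module Defs where

open import Data.Nat using (ℕ; _<_; _≤_; _*_; _+_; _^_)
open import Data.Fin using (Fin)
open import Data.Fin.Subset using (Subset; _∈_; ∣_∣)
open import Data.Bool using (_∧_)
open import Data.Vec using (lookup; tabulate)
open import Data.Product using (Σ; ∃; ∃-syntax; _×_; _,_)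
open import Function.Bundles using (_⇔_)
open import Function.Definitions using (Injective)
open import Relation.Binary.PropositionalEquality using (_≡_)
open import Relation.Nullary using (¬_)
open import Data.Product using (proj₁)
open import Function.Construct.Composition using (_↔-∘_)
open import Function.Construct.Identity using (↔-id)
open import Function.Construct.Symmetry using (↔-sym)
open import Function.Bundles using (Inverse; _↔_)

Perm : ℕ → Set
Perm v = Fin v ↔ Fin v

app : ∀ {v} → Perm v → Fin v → Fin v
app σ = Inverse.to σ

countPairBlocks : ∀ {v b} → (Fin b → Subset v) → Fin v → Fin v → ℕ
countPairBlocks {b = b} B x y = ∣ tabulate (λ j → lookup (B j) x ∧ lookup (B j) y) ∣

-- A 2-(v,k,λ) design on the point set Fin v with b blocks B 0 … B (b-1):
-- blocks are pairwise distinct k-subsets (the block set is a set of k-subsets),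
-- λ ≥ 1, and each pair of distinct points lies in exactly λ blocks.
record Is2Design (v k lam b : ℕ) (B : Fin b → Subset v) : Set where
  field
    blocksDistinct : Injective _≡_ _≡_ B
    blockSize      : ∀ j → ∣ B j ∣ ≡ k
    lam-pos          : 1 ≤ lam
    balanced       : ∀ x y → ¬ (x ≡ y) → countPairBlocks B x y ≡ lam

Nontrivial : ℕ → ℕ → Set
Nontrivial v k = (2 < k) × (k < v)

-- σ is an automorphism: it maps every block onto a block.
-- (σ(B j) = B l  iff  ∀ z, z ∈ B j ⇔ σ z ∈ B l, as σ is a bijection.)
MapsBlockTo : ∀ {v b} → (Fin b → Subset v) → Perm v → Fin b → Fin b → Set
MapsBlockTo B σ j l = ∀ z → (z ∈ B j) ⇔ (app σ z ∈ B l)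

IsAutomorphism : ∀ {v b} → (Fin b → Subset v) → Perm v → Set
IsAutomorphism B σ = ∀ j → ∃[ l ] MapsBlockTo B σ j l

record IsAutGroup {v b} (B : Fin b → Subset v) (G : Perm v → Set) : Set₁ where
  field
    aut     : ∀ σ → G σ → IsAutomorphism B σ
    id-mem  : G (↔-id (Fin v))
    ∘-mem   : ∀ σ τ → G σ → G τ → G (σ ↔-∘ τ)
    inv-mem : ∀ σ → G σ → G (↔-sym σ)

FlagTransitive : ∀ {v b} → (Fin b → Subset v) → (Perm v → Set) → Set
FlagTransitive B G =
  ∀ x j y l → x ∈ B j → y ∈ B l →
    ∃[ g ] (G g × (app g x ≡ y) × MapsBlockTo B g j l)

-- Point-imprimitive: G preserves a partition of the points (given as the
-- fibres of a labelling c) that is neither the partition into singletons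
-- (some class has two distinct points) nor the one-part partition
-- (some two points lie in different classes).
PointImprimitive : ∀ {v} → (Perm v → Set) → Set
PointImprimitive {v} G =
  ∃ λ (c : Fin v → ℕ) → (  (∃[ x ] ∃[ y ] (¬ (x ≡ y) × c x ≡ c y))
          × (∃[ x ] ∃[ y ] ¬ (c x ≡ c y))
          × (∀ g → G g → ∀ x y → c x ≡ c y → c (app g x) ≡ c (app g y)) )

-- Counting flags through a point gives r(k − 1) = λ(v − 1), and the variance of the sizes of the
-- intersections with a fixed block gives Fisher's inequality k ≤ r.  Flag-transitivity makes
-- ℓ = |B ∩ Δ| the same for every flag (x, B) and the class Δ of x, so counting pairs inside a class
-- gives r(ℓ − 1) = λ(c − 1), where all classes have the same size c and there are d of them.  Hence
-- c divides k − ℓ, say k = ℓ + mc, and Fisher's inequality yields (ℓ − 1)m < λ.  Finally k divides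
-- bk = cdr while gcd(k, c) ∣ ℓ, gcd(k, d) ∣ m + 1 and gcd(k, r) ∣ λ(ℓ + m), so
-- k ≤ ℓ(m + 1)λ(ℓ + m) ≤ 2λ²(λ + 1).
module Submission where

open import Defs
open import Data.Bool using (Bool; true; false; _∧_)
open import Data.Empty using (⊥-elim)
open import Data.Fin using (Fin; Fin′; zero; suc; punchIn; inject; fromℕ<)
import Data.Fin as Fin
open import Data.Fin.Properties
  using (punchInᵢ≢i; punchIn-punchOut; toℕ-injective; toℕ-inject; toℕ-fromℕ<; all?; ¬∀⟶∃¬-smallest)
import Data.Fin.Properties as Finₚ
open import Data.Fin.Subset using (Subset; _∈_; ∣_∣)
open import Data.Nat
open import Data.Nat.Coprimality using (Coprime; coprime-divisor; coprime-+; 1-coprimeTo)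
open import Data.Nat.Divisibility
open import Data.Nat.GCD using (gcd; gcd[m,n]∣m; gcd[m,n]∣n; gcd-greatest; c*gcd[m,n]≡gcd[cm,cn])
open import Data.Nat.Properties
open import Algebra.Properties.CommutativeSemigroup *-commutativeSemigroup
  using (x∙yz≈y∙xz; x∙yz≈xz∙y; x∙yz≈y∙zx; x∙yz≈z∙xy; xy∙z≈y∙xz)
open import Algebra.Properties.Semiring.Sum +-*-semiring
  using (sum; sum-cong-≗; *-distribˡ-sum; *-distribʳ-sum; ∑-distrib-+; ∑-comm; sum-remove; ∑-permute)
open import Data.Nat.Tactic.RingSolver using (solve-∀)
open import Data.Product using (_,_; ∃-syntax; _×_; proj₁; proj₂)
open import Data.Vec using ([]; _∷_; lookup; tabulate)
open import Data.Vec.Properties using (lookup∘tabulate; []=⇒lookup; lookup⇒[]=)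
open import Function using (_∘_)
open import Function.Bundles using (Equivalence)
open import Relation.Binary.Definitions using (tri<; tri≈; tri>)
open import Relation.Binary.PropositionalEquality
open import Relation.Nullary using (¬_; Dec; does; yes; no)
open import Relation.Nullary.Decidable using (dec-true; dec-false; decidable-stable; ¬?)

-- Finite sums over Fin n

sum-const : ∀ n a → sum {n} (λ _ → a) ≡ n * a
sum-const zero    a = refl
sum-const (suc n) a = cong (a +_) (sum-const n a)

sum-mono-≤ : ∀ {n} {f g : Fin n → ℕ} → (∀ i → f i ≤ g i) → sum f ≤ sum g
sum-mono-≤ {zero}  f≤g = z≤n
sum-mono-≤ {suc n} f≤g = +-mono-≤ (f≤g zero) (sum-mono-≤ (f≤g ∘ suc))

sum-mono-< : ∀ {n} {f g : Fin n → ℕ} → (∀ i → f i ≤ g i) → ∀ i → f i < g i → sum f < sum g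
sum-mono-< {suc n} {f} {g} f≤g i fi<gi = subst₂ _<_ (sym (sum-remove {i = i} f)) (sym (sum-remove {i = i} g))
  (+-mono-<-≤ fi<gi (sum-mono-≤ (f≤g ∘ punchIn i)))

term≤sum : ∀ {n} (f : Fin n → ℕ) i → f i ≤ sum f
term≤sum {suc n} f i = subst (f i ≤_) (sym (sum-remove {i = i} f)) (m≤m+n (f i) _)

two-terms≤sum : ∀ {n} (f : Fin n → ℕ) {i j} → ¬ i ≡ j → f i + f j ≤ sum f
two-terms≤sum {suc n} f {i} {j} i≢j = subst (f i + f j ≤_) (sym (sum-remove {i = i} f))
  (+-monoʳ-≤ (f i) (subst (λ z → f z ≤ sum (f ∘ punchIn i)) (punchIn-punchOut i≢j)
    (term≤sum (f ∘ punchIn i) _)))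

sum-agree-except : ∀ {n} {f g : Fin (suc n) → ℕ} i → (∀ j → ¬ j ≡ i → f j ≡ g j) →
  sum f + g i ≡ sum g + f i
sum-agree-except {f = f} {g} i f≡g = begin
  sum f + g i                      ≡⟨ cong (_+ g i) (sum-remove {i = i} f) ⟩
  f i + sum (f ∘ punchIn i) + g i  ≡⟨ cong (λ s → f i + s + g i) (sum-cong-≗ (λ j → f≡g _ (punchInᵢ≢i i j))) ⟩
  f i + sum (g ∘ punchIn i) + g i  ≡⟨ swap (f i) (sum (g ∘ punchIn i)) (g i) ⟩
  g i + sum (g ∘ punchIn i) + f i  ≡⟨ cong (_+ f i) (sym (sum-remove {i = i} g)) ⟩
  sum g + f i                      ∎
  where
  open ≡-Reasoning
  swap : ∀ x y z → x + y + z ≡ z + y + x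
  swap = solve-∀

sum-single : ∀ {n} {f : Fin (suc n) → ℕ} i → (∀ j → ¬ j ≡ i → f j ≡ 0) → sum f ≡ f i
sum-single {n} {f} i f≡0 = +-cancelʳ-≡ 0 _ _ (begin
  sum f + 0                    ≡⟨ sum-agree-except {g = λ _ → 0} i f≡0 ⟩
  sum {suc n} (λ _ → 0) + f i  ≡⟨ cong (_+ f i) (trans (sum-const (suc n) 0) (*-zeroʳ (suc n))) ⟩
  f i                          ≡⟨ sym (+-identityʳ (f i)) ⟩
  f i + 0                      ∎)
  where open ≡-Reasoning

∃-positive-term : ∀ {n} (f : Fin n → ℕ) → 0 < sum f → ∃[ i ] 0 < f i
∃-positive-term {suc n} f 0<sum with f zero in eq
... | suc _ = zero , subst (0 <_) (sym eq) z<s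
... | zero with ∃-positive-term (f ∘ suc) 0<sum
...   | i , 0<fi = suc i , 0<fi

sum-*-sum : ∀ {m n} (f : Fin m → ℕ) (g : Fin n → ℕ) →
  sum f * sum g ≡ sum (λ i → sum (λ j → f i * g j))
sum-*-sum f g = trans (*-distribʳ-sum (sum g) f) (sum-cong-≗ (λ i → *-distribˡ-sum (f i) g))

2mn≤m²+n² : ∀ m n → 2 * (m * n) ≤ m * m + n * n
2mn≤m²+n² zero    n       = z≤n
2mn≤m²+n² (suc m) zero    = subst (_≤ suc m * suc m + 0) (sym (cong (2 *_) (*-zeroʳ (suc m)))) z≤n
2mn≤m²+n² (suc m) (suc n) = subst₂ _≤_ (expand m n) (expand′ m n)
  (+-monoˡ-≤ (2 * m + 2 * n + 2) (2mn≤m²+n² m n))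
  where
  expand : ∀ m n → 2 * (m * n) + (2 * m + 2 * n + 2) ≡ 2 * (suc m * suc n)
  expand = solve-∀
  expand′ : ∀ m n → m * m + n * n + (2 * m + 2 * n + 2) ≡ suc m * suc m + suc n * suc n
  expand′ = solve-∀

cauchy-schwarz : ∀ {n} (f : Fin n → ℕ) → sum f * sum f ≤ n * sum (λ i → f i * f i)
cauchy-schwarz {n} f = *-cancelˡ-≤ 2 (begin
  2 * (sum f * sum f)                              ≡⟨ cong (2 *_) (sum-*-sum f f) ⟩
  2 * sum (λ i → sum (λ j → f i * f j))            ≡⟨ *-distribˡ-sum 2 (λ i → sum (λ j → f i * f j)) ⟩
  sum (λ i → 2 * sum (λ j → f i * f j))            ≡⟨ sum-cong-≗ (λ i → *-distribˡ-sum 2 (λ j → f i * f j)) ⟩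
  sum (λ i → sum (λ j → 2 * (f i * f j)))          ≤⟨ sum-mono-≤ (λ i → sum-mono-≤ (λ j → 2mn≤m²+n² (f i) (f j))) ⟩
  sum (λ i → sum (λ j → f i * f i + f j * f j))    ≡⟨ sum-cong-≗ (λ i → ∑-distrib-+ {n} (λ _ → f i * f i) (λ j → f j * f j)) ⟩
  sum (λ i → sum {n} (λ _ → f i * f i) + Q)        ≡⟨ sum-cong-≗ (λ i → cong (_+ Q) (sum-const n (f i * f i))) ⟩
  sum (λ i → n * (f i * f i) + Q)                  ≡⟨ ∑-distrib-+ {n} (λ i → n * (f i * f i)) (λ _ → Q) ⟩
  sum (λ i → n * (f i * f i)) + sum {n} (λ _ → Q)  ≡⟨ cong₂ _+_ (sym (*-distribˡ-sum n (λ i → f i * f i))) (sum-const n Q) ⟩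
  n * Q + n * Q                                    ≡⟨ double (n * Q) ⟩
  2 * (n * Q)                                           ∎)
  where
  open ≤-Reasoning
  Q = sum (λ i → f i * f i)
  double : ∀ x → x + x ≡ 2 * x
  double = solve-∀

-- Linear relations between design parameters

m+n≡o+p∧o≤m⇒n≤p : ∀ {m n o p} → m + n ≡ o + p → o ≤ m → n ≤ p
m+n≡o+p∧o≤m⇒n≤p {m} {n} {o} {p} eq o≤m =
  +-cancelˡ-≤ o n p (≤-trans (+-monoˡ-≤ n o≤m) (≤-reflexive eq))

relation-difference : ∀ r lam x y e w →
  r * x + lam ≡ r + y * lam → r * (x + e) + lam ≡ r + (y + w) * lam → r * e ≡ lam * w
relation-difference r lam x y e w h₁ h₂ = +-cancelˡ-≡ (r + y * lam) _ _ (begin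
  r + y * lam + r * e  ≡⟨ cong (_+ r * e) (sym h₁) ⟩
  r * x + lam + r * e  ≡⟨ expand r x e lam ⟩
  r * (x + e) + lam    ≡⟨ h₂ ⟩
  r + (y + w) * lam    ≡⟨ expand′ r y w lam ⟩
  r + y * lam + lam * w  ∎)
  where
  open ≡-Reasoning
  expand : ∀ r x e l → r * x + l + r * e ≡ r * (x + e) + l
  expand = solve-∀
  expand′ : ∀ r y w l → r + (y + w) * l ≡ r + y * l + l * w
  expand′ = solve-∀

affine-cancel : ∀ {x y k z w} → 1 < k → x * k + z ≡ x + w → y * k + z ≡ y + w → x ≡ y
affine-cancel {x} {y} {suc k₁@(suc _)} {z} {w} (s≤s (s≤s z≤n)) hx hy =
  *-cancelʳ-≡ x y k₁ (+-cancelʳ-≡ z _ _ (trans (reduce x hx) (sym (reduce y hy))))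
  where
  reduce : ∀ t → t * suc k₁ + z ≡ t + w → t * k₁ + z ≡ w
  reduce t h = +-cancelˡ-≡ t _ _ (trans (sym (+-assoc t (t * k₁) z)) (trans (cong (_+ z) (sym (*-suc t k₁))) h))

-- Fisher's inequality

-- With S₁ and S₂ the sum and the sum of squares of the sizes |B₀ ∩ B| over the b′ blocks B ≠ B₀,
-- the variance identity  k(v − 1)(b′S₂ − S₁²) = kr(v − k)²(r − k)  holds.  Writing k = 1 + k₁,
-- r = 1 + r₁, v = k + w and S₁ = k r₁, it is made subtraction-free by adding α, β, γ times the
-- relations  b′k + k = vr,  S₂ + k² + kλ = k²λ + kr  and  r k₁ = λ(v − 1)  to both sides.
variance-identity : ∀ k₁ w r₁ lam b′ S₂ →
  let k = suc k₁ ; r = suc r₁ ; v₁ = k₁ + w ; v = suc v₁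
      P = k * r * (w * w) ; α = v₁ * S₂ ; β = (k * r₁ + w * r) * v₁ ; γ = (k * r₁ + w * r) * (k * k₁)
  in k * v₁ * (b′ * S₂) + P * k + (α * (v * r) + β * (k * k * lam + k * r) + γ * (r * k₁))
   ≡ k * v₁ * (k * r₁ * (k * r₁)) + P * r + (α * (b′ * k + k) + β * (S₂ + k * k + k * lam) + γ * (lam * v₁))
variance-identity = solve-∀

fisher-bound : ∀ {v k lam r b′ S₁ S₂} → 0 < k → k < v → 0 < r →
  r * k + lam ≡ r + v * lam → b′ * k + k ≡ v * r →
  S₁ + k ≡ k * r → S₂ + k * k + k * lam ≡ k * k * lam + k * r →
  S₁ * S₁ ≤ b′ * S₂ → k ≤ r
fisher-bound {k = suc k₁} {lam} {suc r₁} {b′} {S₁} {S₂} _ k<v _ rk≡ b′k≡ S₁≡ S₂≡ S₁²≤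
  with m≤n⇒∃[o]m+o≡n k<v
... | w′ , refl =
  *-cancelˡ-≤ P (m+n≡o+p∧o≤m⇒n≤p variance (*-monoʳ-≤ (k * v₁) S₁²≤′))
  where
  k = suc k₁
  r = suc r₁
  w = suc w′
  v₁ = k₁ + w
  P = k * r * (w * w)
  v≡ : suc k + w′ ≡ suc v₁
  v≡ = cong suc (sym (+-suc k₁ w′))
  S₁≡kr₁ : S₁ ≡ k * r₁
  S₁≡kr₁ = +-cancelʳ-≡ k S₁ (k * r₁) (trans S₁≡ (trans (*-suc k r₁) (+-comm k (k * r₁))))
  S₁²≤′ : k * r₁ * (k * r₁) ≤ b′ * S₂
  S₁²≤′ = subst (λ s → s * s ≤ b′ * S₂) S₁≡kr₁ S₁²≤
  rk₁≡ : r * k₁ ≡ lam * v₁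
  rk₁≡ = relation-difference r lam 1 1 k₁ v₁ (cong₂ _+_ (*-identityʳ r) (sym (*-identityˡ lam)))
           (trans rk≡ (cong (λ t → r + t * lam) v≡))
  variance : k * v₁ * (b′ * S₂) + P * k ≡ k * v₁ * (k * r₁ * (k * r₁)) + P * r
  variance = +-cancelʳ-≡ _ _ _ (trans (variance-identity k₁ w r₁ lam b′ S₂)
    (cong (k * v₁ * (k * r₁ * (k * r₁)) + P * r +_)
      (cong₂ _+_ (cong₂ _+_ (cong (v₁ * S₂ *_) (trans b′k≡ (cong (_* r) v≡))) (cong (β *_) S₂≡))
                 (cong (γ *_) (sym rk₁≡)))))
    where
    β = (k * r₁ + w * r) * v₁
    γ = (k * r₁ + w * r) * (k * k₁)

-- The divisibility bound

∣-gcd-*ʳ : ∀ {k} x y → k ∣ x * y → k ∣ gcd k x * y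
∣-gcd-*ʳ {k} x y k∣xy = subst (k ∣_) (trans (sym (c*gcd[m,n]≡gcd[cm,cn] y k x)) (*-comm y (gcd k x)))
  (gcd-greatest (n∣m*n y) (subst (k ∣_) (*-comm x y) k∣xy))

∣-*-via-gcds : ∀ {k x′ y′ z′} x y z → k ∣ x * y * z →
  gcd k x ∣ x′ → gcd k y ∣ y′ → gcd k z ∣ z′ → k ∣ x′ * y′ * z′
∣-*-via-gcds {k} x y z k∣xyz gx gy gz =
  ∣-trans k∣gcds (*-pres-∣ (*-pres-∣ gx gy) gz)
  where
  X = gcd k x
  Y = gcd k y
  Z = gcd k z
  k∣gcds : k ∣ X * Y * Z
  k∣gcds = subst (k ∣_) (trans (x∙yz≈y∙zx Z X Y) (sym (*-assoc X Y Z)))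
    (∣-gcd-*ʳ z (X * Y) (subst (k ∣_) (x∙yz≈y∙zx Y z X)
    (∣-gcd-*ʳ y (z * X) (subst (k ∣_) (x∙yz≈y∙zx X y z)
    (∣-gcd-*ʳ x (y * z) (subst (k ∣_) (*-assoc x y z) k∣xyz))))))

gcd∣-of-combination : ∀ {k t} n s x → n * k ≡ s * x + t → gcd k x ∣ t
gcd∣-of-combination {k} n s x eq =
  ∣m+n∣m⇒∣n (subst (gcd k x ∣_) eq (∣n⇒∣m*n n (gcd[m,n]∣m k x))) (∣n⇒∣m*n s (gcd[m,n]∣n k x))

suc∣-of-coprime : ∀ c′ e w → c′ * e ≡ suc c′ * w → suc c′ ∣ e
suc∣-of-coprime c′ e w eq = coprime-divisor coprime (divides w (trans eq (*-comm (suc c′) w)))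
  where
  coprime = subst (λ n → Coprime n c′) (+-comm c′ 1) (coprime-+ (1-coprimeTo c′))

parameter-bound : ∀ lam a m → 1 ≤ a → 1 ≤ m → m * a < lam →
  suc a * suc m * (lam * (suc a + m)) ≤ 2 * (lam * lam) * (lam + 1)
parameter-bound lam a@(suc a′) m@(suc m′) _ _ ma<lam = begin
  suc a * suc m * (lam * (suc a + m))  ≡⟨ x∙yz≈y∙xz (suc a * suc m) lam (suc a + m) ⟩
  lam * (suc a * suc m * (suc a + m))  ≤⟨ *-monoʳ-≤ lam (*-mono-≤ product≤ sum≤) ⟩
  lam * (2 * lam * (lam + 1))          ≡⟨ regroup lam ⟩
  2 * (lam * lam) * (lam + 1)          ∎
  where
  open ≤-Reasoning
  regroup : ∀ l → l * (2 * l * (l + 1)) ≡ 2 * (l * l) * (l + 1)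
  regroup = solve-∀
  product≤ : suc a * suc m ≤ 2 * lam
  product≤ = begin
    suc a * suc m            ≤⟨ m≤m+n (suc a * suc m) (a′ * m′) ⟩
    suc a * suc m + a′ * m′  ≡⟨ expand a′ m′ ⟩
    2 * suc (m * a)          ≤⟨ *-monoʳ-≤ 2 ma<lam ⟩
    2 * lam                  ∎
    where
    expand : ∀ a′ m′ → suc (suc a′) * suc (suc m′) + a′ * m′ ≡ 2 * suc (suc m′ * suc a′)
    expand = solve-∀
  sum≤ : suc a + m ≤ lam + 1
  sum≤ = begin
    suc a + m            ≤⟨ m≤m+n (suc a + m) (a′ * m′) ⟩
    suc a + m + a′ * m′  ≡⟨ expand a′ m′ ⟩
    suc (m * a) + 1      ≤⟨ +-monoˡ-≤ 1 ma<lam ⟩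
    lam + 1              ∎
    where
    expand : ∀ a′ m′ → suc (suc a′) + suc m′ + a′ * m′ ≡ suc (suc m′ * suc a′) + 1
    expand = solve-∀

cross-multiply : ∀ {lam r a c′ e w} .{{_ : NonZero lam}} →
  r * a ≡ lam * c′ → r * e ≡ lam * w → c′ * e ≡ a * w
cross-multiply {lam} {r} {a} {c′} {e} {w} ra≡ re≡ = *-cancelˡ-≡ _ _ lam (begin
  lam * (c′ * e)  ≡⟨ sym (*-assoc lam c′ e) ⟩
  lam * c′ * e    ≡⟨ cong (_* e) (sym ra≡) ⟩
  r * a * e       ≡⟨ xy∙z≈y∙xz r a e ⟩
  a * (r * e)     ≡⟨ cong (a *_) re≡ ⟩
  a * (lam * w)   ≡⟨ x∙yz≈y∙xz a lam w ⟩
  lam * (a * w)  ∎)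
  where open ≡-Reasoning

proportion⇒multiple : ∀ {lam r a c′ d′ e} → 1 ≤ lam → 1 ≤ d′ →
  r * a ≡ lam * c′ → r * e ≡ lam * (suc c′ * d′) →
  ∃[ m ] (1 ≤ m × e ≡ m * suc c′ × c′ * m ≡ a * d′)
proportion⇒multiple {lam@(suc _)} {r} {a} {c′} {d′} {e} λ≥1 d′≥1 ra≡ re≡
  with suc∣-of-coprime c′ e (a * d′)
       (trans (cross-multiply {lam} {r} {a} {c′} {e} ra≡ re≡) (x∙yz≈y∙xz a (suc c′) d′))
... | divides zero refl =
  ⊥-elim (<⇒≢ (*-mono-≤ λ≥1 (*-mono-≤ (s≤s (z≤n {c′})) d′≥1)) (sym (trans (sym re≡) (*-zeroʳ r))))
... | divides m@(suc _) e≡mc = m , s≤s z≤n , e≡mc , *-cancelʳ-≡ _ _ (suc c′) (begin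
  c′ * m * suc c′    ≡⟨ *-assoc c′ m (suc c′) ⟩
  c′ * (m * suc c′)  ≡⟨ cong (c′ *_) (sym e≡mc) ⟩
  c′ * e             ≡⟨ cross-multiply {lam} {r} {a} {c′} {e} ra≡ re≡ ⟩
  a * (suc c′ * d′)  ≡⟨ x∙yz≈xz∙y a (suc c′) d′ ⟩
  a * d′ * suc c′    ∎)
  where open ≡-Reasoning

k∣parameter-product : ∀ {lam r b a c′ d′ m} → r * a ≡ lam * c′ → c′ * m ≡ a * d′ →
  let k = suc a + m * suc c′ in
  b * k ≡ suc c′ * suc d′ * r → k ∣ suc a * suc m * (lam * (suc a + m))
k∣parameter-product {lam} {r} {b} {a} {c′} {d′} {m} ra≡ c′m≡ad′ bk≡ =
  ∣-*-via-gcds c d r (divides b (sym bk≡))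
    (gcd∣-of-combination 1 m c (trans (+-identityʳ k) (+-comm (suc a) (m * c))))
    (gcd∣-of-combination 1 a d k≡ad+M)
    (gcd∣-of-combination lam (m * a) r λk≡mar+λ[L+m])
  where
  open ≡-Reasoning
  c = suc c′
  d = suc d′
  k = suc a + m * c
  k≡ad+M : 1 * k ≡ a * d + suc m
  k≡ad+M = begin
    1 * k               ≡⟨ expand a m c′ ⟩
    a + c′ * m + suc m  ≡⟨ cong (λ t → a + t + suc m) c′m≡ad′ ⟩
    a + a * d′ + suc m  ≡⟨ cong (_+ suc m) (sym (*-suc a d′)) ⟩
    a * d + suc m       ∎
    where
    expand : ∀ a m c′ → 1 * (suc a + m * suc c′) ≡ a + c′ * m + suc m
    expand = solve-∀
  λk≡mar+λ[L+m] : lam * k ≡ m * a * r + lam * (suc a + m)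
  λk≡mar+λ[L+m] = begin
    lam * k                             ≡⟨ expand lam a m c′ ⟩
    m * (lam * c′) + lam * (suc a + m)  ≡⟨ cong (λ t → m * t + lam * (suc a + m)) (sym ra≡) ⟩
    m * (r * a) + lam * (suc a + m)     ≡⟨ cong (_+ lam * (suc a + m)) (x∙yz≈xz∙y m r a) ⟩
    m * a * r + lam * (suc a + m)       ∎
    where
    expand : ∀ l a m c′ → l * (suc a + m * suc c′) ≡ m * (l * c′) + l * (suc a + m)
    expand = solve-∀

imprimitive-bound-shifted : ∀ {lam r b a c′ d′ e} → 1 ≤ lam → 1 ≤ c′ → 1 ≤ d′ →
  r * a ≡ lam * c′ → r * e ≡ lam * (suc c′ * d′) →
  b * (suc a + e) ≡ suc c′ * suc d′ * r → suc a + e ≤ r →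
  suc a + e ≤ 2 * (lam * lam) * (lam + 1)
imprimitive-bound-shifted {lam} {r} {a = zero} {c′} λ≥1 c′≥1 _ ra≡ _ _ _ =
  ⊥-elim (<⇒≢ (*-mono-≤ λ≥1 c′≥1) (sym (trans (sym ra≡) (*-zeroʳ r))))
imprimitive-bound-shifted {lam@(suc _)} {r} {b} {a@(suc _)} {c′} {d′} {e} λ≥1 c′≥1 d′≥1 ra≡ re≡ bk≡ k≤r
  with proportion⇒multiple {lam} {r} {a} {c′} {d′} {e} λ≥1 d′≥1 ra≡ re≡
... | m , m≥1 , refl , c′m≡ad′ =
  ≤-trans (∣⇒≤ (k∣parameter-product {lam} {r} {b} {a} {c′} {d′} {m} ra≡ c′m≡ad′ bk≡))
          (parameter-bound lam a m (s≤s z≤n) m≥1 ma<lam)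
  where
  c = suc c′
  ma<lam : m * a < lam
  ma<lam = *-cancelˡ-< c (m * a) lam (begin-strict
    c * (m * a)          ≡⟨ trans (sym (*-assoc c m a)) (cong (_* a) (*-comm c m)) ⟩
    m * c * a            ≤⟨ *-monoˡ-≤ a (m≤n+m (m * c) (suc a)) ⟩
    (suc a + m * c) * a  ≤⟨ *-monoˡ-≤ a k≤r ⟩
    r * a                ≡⟨ ra≡ ⟩
    lam * c′             <⟨ *-monoʳ-< lam (n<1+n c′) ⟩
    lam * c              ≡⟨ *-comm lam c ⟩
    c * lam              ∎)
    where open ≤-Reasoning

imprimitive-bound : ∀ {lam r b k v L c d} → 1 ≤ lam →
  r * k + lam ≡ r + v * lam → r * L + lam ≡ r + c * lam →
  b * k ≡ v * r → v ≡ c * d → k ≤ r → 1 ≤ L → L ≤ k → 2 ≤ c → c < v →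
  k ≤ 2 * (lam * lam) * (lam + 1)
imprimitive-bound {lam} {r} {b} {k} {L = suc a} {suc c′} {d} λ≥1 rk≡ rL≡ bk≡ refl k≤r _ L≤k (s≤s c′≥1) c<v
  with m≤n⇒∃[o]m+o≡n L≤k | d
... | e , refl | zero = ⊥-elim (n≮0 (subst (suc c′ <_) (*-zeroʳ (suc c′)) c<v))
... | e , refl | suc zero = ⊥-elim (<-irrefl (sym (*-identityʳ (suc c′))) c<v)
... | e , refl | suc (suc d″) =
  imprimitive-bound-shifted {b = b} λ≥1 c′≥1 (s≤s z≤n) ra≡ re≡ bk≡ k≤r
  where
  c = suc c′
  ra≡ : r * a ≡ lam * c′
  ra≡ = relation-difference r lam 1 1 a c′ (cong₂ _+_ (*-identityʳ r) (sym (*-identityˡ lam))) rL≡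
  re≡ : r * e ≡ lam * (c * suc d″)
  re≡ = relation-difference r lam (suc a) c e (c * suc d″) rL≡
          (trans rk≡ (cong (λ t → r + t * lam) (*-suc c (suc d″))))

-- Incidence counting in a flag-transitive imprimitive design

𝟙 : Bool → ℕ
𝟙 true  = 1
𝟙 false = 0

𝟙≤1 : ∀ a → 𝟙 a ≤ 1
𝟙≤1 true  = s≤s z≤n
𝟙≤1 false = z≤n

𝟙-idem : ∀ a → 𝟙 a * 𝟙 a ≡ 𝟙 a
𝟙-idem true  = refl
𝟙-idem false = refl

𝟙-∧ : ∀ a c → 𝟙 (a ∧ c) ≡ 𝟙 a * 𝟙 c
𝟙-∧ true  c = sym (+-identityʳ (𝟙 c))
𝟙-∧ false c = refl

∣p∣≡sum𝟙 : ∀ {n} (p : Subset n) → ∣ p ∣ ≡ sum (λ i → 𝟙 (lookup p i))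
∣p∣≡sum𝟙 []          = refl
∣p∣≡sum𝟙 (true ∷ p)  = cong suc (∣p∣≡sum𝟙 p)
∣p∣≡sum𝟙 (false ∷ p) = ∣p∣≡sum𝟙 p

inject-fromℕ< : ∀ {n} {i j : Fin n} (j<i : j Fin.< i) → inject {i = i} (fromℕ< j<i) ≡ j
inject-fromℕ< j<i = toℕ-injective (trans (toℕ-inject (fromℕ< j<i)) (toℕ-fromℕ< j<i))

module Incidence {v₁ k lam b₁ : ℕ} {B : Fin (suc b₁) → Subset (suc v₁)}
  (design : Is2Design (suc v₁) k lam (suc b₁) B) (2<k : 2 < k) (k<v : k < suc v₁) where

  open Is2Design design

  v b : ℕ
  v = suc v₁
  b = suc b₁

  I : Fin v → Fin b → ℕ
  I x j = 𝟙 (lookup (B j) x)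

  ∈⇒I≡1 : ∀ {x j} → x ∈ B j → I x j ≡ 1
  ∈⇒I≡1 x∈Bj = cong 𝟙 ([]=⇒lookup x∈Bj)

  I>0⇒∈ : ∀ {x j} → 0 < I x j → x ∈ B j
  I>0⇒∈ {x} {j} 0<I with lookup (B j) x in x∈?
  ... | true = lookup⇒[]= x (B j) x∈?

  block-size : ∀ j → sum (λ x → I x j) ≡ k
  block-size j = trans (sym (∣p∣≡sum𝟙 (B j))) (blockSize j)

  common : Fin v → Fin v → ℕ
  common x y = sum (λ j → I x j * I y j)

  common-off-diagonal : ∀ x y → ¬ x ≡ y → common x y ≡ lam
  common-off-diagonal x y x≢y = trans (sym (trans (∣p∣≡sum𝟙 (tabulate both))
    (sum-cong-≗ (λ j → trans (cong 𝟙 (lookup∘tabulate both j)) (𝟙-∧ (lookup (B j) x) (lookup (B j) y)))))) (balanced x y x≢y)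
    where
    both = λ j → lookup (B j) x ∧ lookup (B j) y

  replication : Fin v → ℕ
  replication x = sum (I x)

  common-diagonal : ∀ x → common x x ≡ replication x
  common-diagonal x = sum-cong-≗ (λ j → 𝟙-idem (lookup (B j) x))

  double-count : ∀ x (w : Fin v → ℕ) →
    sum (λ j → I x j * sum (λ y → I y j * w y)) ≡ sum (λ y → w y * common x y)
  double-count x w = begin
    sum (λ j → I x j * sum (λ y → I y j * w y))    ≡⟨ sum-cong-≗ (λ j → *-distribˡ-sum (I x j) (λ y → I y j * w y)) ⟩
    sum (λ j → sum (λ y → I x j * (I y j * w y)))  ≡⟨ ∑-comm (λ j y → I x j * (I y j * w y)) ⟩
    sum (λ y → sum (λ j → I x j * (I y j * w y)))  ≡⟨ sum-cong-≗ (λ y → sum-cong-≗ (λ j → x∙yz≈z∙xy (I x j) (I y j) (w y))) ⟩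
    sum (λ y → sum (λ j → w y * (I x j * I y j)))  ≡⟨ sum-cong-≗ (λ y → sym (*-distribˡ-sum (w y) (λ j → I x j * I y j))) ⟩
    sum (λ y → w y * common x y)                   ∎
    where open ≡-Reasoning

  weighted-pair-count : ∀ x (w : Fin v → ℕ) →
    sum (λ y → w y * common x y) + w x * lam ≡ sum w * lam + w x * replication x
  weighted-pair-count x w = begin
    sum (λ y → w y * common x y) + w x * lam  ≡⟨ sum-agree-except x (λ y y≢x → cong (w y *_) (common-off-diagonal x y (y≢x ∘ sym))) ⟩
    sum (λ y → w y * lam) + w x * common x x  ≡⟨ cong₂ _+_ (sym (*-distribʳ-sum lam w)) (cong (w x *_) (common-diagonal x)) ⟩
    sum w * lam + w x * replication x         ∎
    where open ≡-Reasoning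

  replication-relation : ∀ x → replication x * k + lam ≡ replication x + v * lam
  replication-relation x = begin
    replication x * k + lam                          ≡⟨ cong (_+ lam) (*-distribʳ-sum k (I x)) ⟩
    sum (λ j → I x j * k) + lam                      ≡⟨ cong (_+ lam) (sum-cong-≗ (λ j → cong (I x j *_) (sym (block-size′ j)))) ⟩
    sum (λ j → I x j * sum (λ y → I y j * 1)) + lam  ≡⟨ cong₂ _+_ (double-count x (λ _ → 1)) (sym (*-identityˡ lam)) ⟩
    sum (λ y → 1 * common x y) + 1 * lam             ≡⟨ weighted-pair-count x (λ _ → 1) ⟩
    sum {v} (λ _ → 1) * lam + 1 * replication x      ≡⟨ cong₂ _+_ (cong (_* lam) (trans (sum-const v 1) (*-identityʳ v))) (*-identityˡ _) ⟩
    v * lam + replication x                          ≡⟨ +-comm (v * lam) (replication x) ⟩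
    replication x + v * lam                          ∎
    where
    open ≡-Reasoning
    block-size′ : ∀ j → sum (λ y → I y j * 1) ≡ k
    block-size′ j = trans (sum-cong-≗ (λ y → *-identityʳ (I y j))) (block-size j)

  r : ℕ
  r = replication zero

  replication-constant : ∀ x → replication x ≡ r
  replication-constant x =
    affine-cancel (<-trans (s≤s (s≤s z≤n)) 2<k) (replication-relation x) (replication-relation zero)

  r>0 : 0 < r
  r>0 with r | replication-relation zero
  ... | suc _ | _    = z<s
  ... | zero  | rel0 = ⊥-elim (<⇒≢ λ<vλ (trans (sym (+-identityˡ lam)) rel0))
    where
    λ<vλ : lam < v * lam
    λ<vλ = subst (_< v * lam) (*-identityˡ lam)
             (*-monoˡ-< lam {{>-nonZero lam-pos}} (<-trans (s≤s (s≤s z≤n)) (<-trans 2<k k<v)))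

  bk≡vr : b * k ≡ v * r
  bk≡vr = begin
    b * k                          ≡⟨ sym (sum-const b k) ⟩
    sum {b} (λ _ → k)              ≡⟨ sum-cong-≗ (λ j → sym (block-size j)) ⟩
    sum (λ j → sum (λ x → I x j))  ≡⟨ ∑-comm (λ j x → I x j) ⟩
    sum replication                ≡⟨ sum-cong-≗ replication-constant ⟩
    sum {v} (λ _ → r)              ≡⟨ sum-const v r ⟩
    v * r                          ∎
    where open ≡-Reasoning

  intersection : Fin b → ℕ
  intersection j = sum (λ x → I x zero * I x j)

  intersection-self : intersection zero ≡ k
  intersection-self = trans (sum-cong-≗ (λ x → 𝟙-idem (lookup (B zero) x))) (block-size zero)

  intersection-sum : sum intersection ≡ k * r
  intersection-sum = begin
    sum intersection                          ≡⟨ ∑-comm (λ j x → I x zero * I x j) ⟩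
    sum (λ x → sum (λ j → I x zero * I x j))  ≡⟨ sum-cong-≗ (λ x → sym (*-distribˡ-sum (I x zero) (I x))) ⟩
    sum (λ x → I x zero * replication x)      ≡⟨ sum-cong-≗ (λ x → cong (I x zero *_) (replication-constant x)) ⟩
    sum (λ x → I x zero * r)                  ≡⟨ sym (*-distribʳ-sum r (λ x → I x zero)) ⟩
    sum (λ x → I x zero) * r                  ≡⟨ cong (_* r) (block-size zero) ⟩
    k * r                                     ∎
    where open ≡-Reasoning

  squared-intersections : sum (λ j → intersection j * intersection j)
                        ≡ sum (λ x → I x zero * sum (λ y → I y zero * common x y))
  squared-intersections = begin
    sum (λ j → n j * n j)                        ≡⟨ sum-cong-≗ (λ j → *-distribʳ-sum (n j) (λ x → a x * I x j)) ⟩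
    sum (λ j → sum (λ x → a x * I x j * n j))    ≡⟨ ∑-comm (λ j x → a x * I x j * n j) ⟩
    sum (λ x → sum (λ j → a x * I x j * n j))    ≡⟨ sum-cong-≗ (λ x → sum-cong-≗ (λ j → *-assoc (a x) (I x j) (n j))) ⟩
    sum (λ x → sum (λ j → a x * (I x j * n j)))  ≡⟨ sum-cong-≗ (λ x → sym (*-distribˡ-sum (a x) (λ j → I x j * n j))) ⟩
    sum (λ x → a x * sum (λ j → I x j * n j))
      ≡⟨ sum-cong-≗ (λ x → cong (a x *_) (sum-cong-≗ (λ j → cong (I x j *_) (sum-cong-≗ (λ y → *-comm (a y) (I y j)))))) ⟩
    sum (λ x → a x * sum (λ j → I x j * sum (λ y → I y j * a y)))
      ≡⟨ sum-cong-≗ (λ x → cong (a x *_) (double-count x a)) ⟩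
    sum (λ x → a x * sum (λ y → a y * common x y))   ∎
    where
    open ≡-Reasoning
    n = intersection
    a : Fin v → ℕ
    a x = I x zero

  pairs-from-block-zero : ∀ x →
    I x zero * sum (λ y → I y zero * common x y) + I x zero * lam ≡ I x zero * (k * lam) + I x zero * r
  pairs-from-block-zero x = begin
    a * S + a * lam        ≡⟨ cong (a * S +_) (sym (absorb lam)) ⟩
    a * S + a * (a * lam)  ≡⟨ sym (*-distribˡ-+ a S (a * lam)) ⟩
    a * (S + a * lam)      ≡⟨ cong (a *_) (weighted-pair-count x (λ y → I y zero)) ⟩
    a * (sum (λ y → I y zero) * lam + a * replication x)
      ≡⟨ cong₂ (λ s t → a * (s * lam + t)) (block-size zero) (cong (a *_) (replication-constant x)) ⟩
    a * (k * lam + a * r)        ≡⟨ *-distribˡ-+ a (k * lam) (a * r) ⟩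
    a * (k * lam) + a * (a * r)  ≡⟨ cong (a * (k * lam) +_) (absorb r) ⟩
    a * (k * lam) + a * r        ∎
    where
    open ≡-Reasoning
    a = I x zero
    S = sum (λ y → I y zero * common x y)
    absorb : ∀ t → a * (a * t) ≡ a * t
    absorb t = trans (sym (*-assoc a a t)) (cong (_* t) (𝟙-idem (lookup (B zero) x)))

  intersection-square-sum :
    sum (λ j → intersection j * intersection j) + k * lam ≡ k * k * lam + k * r
  intersection-square-sum = begin
    sum (λ j → intersection j * intersection j) + k * lam
      ≡⟨ cong₂ _+_ squared-intersections (cong (_* lam) (sym (block-size zero))) ⟩
    sum row + sum a * lam                  ≡⟨ cong (sum row +_) (*-distribʳ-sum lam a) ⟩
    sum row + sum (λ x → a x * lam)        ≡⟨ sym (∑-distrib-+ row (λ x → a x * lam)) ⟩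
    sum (λ x → row x + a x * lam)          ≡⟨ sum-cong-≗ pairs-from-block-zero ⟩
    sum (λ x → a x * (k * lam) + a x * r)  ≡⟨ ∑-distrib-+ (λ x → a x * (k * lam)) (λ x → a x * r) ⟩
    sum (λ x → a x * (k * lam)) + sum (λ x → a x * r)
      ≡⟨ cong₂ _+_ (sym (*-distribʳ-sum (k * lam) a)) (sym (*-distribʳ-sum r a)) ⟩
    sum a * (k * lam) + sum a * r  ≡⟨ cong (λ s → s * (k * lam) + s * r) (block-size zero) ⟩
    k * (k * lam) + k * r          ≡⟨ cong (_+ k * r) (sym (*-assoc k k lam)) ⟩
    k * k * lam + k * r            ∎
    where
    open ≡-Reasoning
    a : Fin v → ℕ
    a x = I x zero
    row : Fin v → ℕ
    row x = a x * sum (λ y → a y * common x y)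

  k≤r : k ≤ r
  k≤r = fisher-bound {b′ = b₁} {S₁ = S₁} {S₂ = S₂} (<-trans z<s 2<k) k<v r>0 (replication-relation zero)
    (trans (+-comm (b₁ * k) k) bk≡vr)
    (trans (+-comm S₁ k) (trans (cong (_+ S₁) (sym intersection-self)) intersection-sum))
    (trans (cong (_+ k * lam) (trans (+-comm S₂ (k * k)) (cong (λ t → t * t + S₂) (sym intersection-self))))
      intersection-square-sum)
    (cauchy-schwarz (intersection ∘ suc))
    where
    S₁ S₂ : ℕ
    S₁ = sum (intersection ∘ suc)
    S₂ = sum (λ j → intersection (suc j) * intersection (suc j))

  module Imprimitivity (G : Perm v → Set) (flag-transitive : FlagTransitive B G) (class : Fin v → ℕ)
    (class-preserved : ∀ g → G g → ∀ x y → class x ≡ class y → class (app g x) ≡ class (app g y)) where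

    same : Fin v → Fin v → ℕ
    same x y = 𝟙 (does (class x ≟ class y))

    same≡1 : ∀ {x y} → class x ≡ class y → same x y ≡ 1
    same≡1 {x} {y} x~y = cong 𝟙 (dec-true (class x ≟ class y) x~y)

    same≡0 : ∀ {x y} → ¬ class x ≡ class y → same x y ≡ 0
    same≡0 {x} {y} x≁y = cong 𝟙 (dec-false (class x ≟ class y) x≁y)

    class-size : Fin v → ℕ
    class-size x = sum (same x)

    meet : Fin v → Fin b → ℕ
    meet x j = sum (λ y → I y j * same x y)

    meet-mono-flag : ∀ {x j y l} → x ∈ B j → y ∈ B l → meet x j ≤ meet y l
    meet-mono-flag {x} {j} {y} {l} x∈Bj y∈Bl with flag-transitive x j y l x∈Bj y∈Bl
    ... | g , g∈G , gx≡y , g[Bj]≡Bl =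
      ≤-trans (sum-mono-≤ image) (≤-reflexive (sym (∑-permute (λ z → I z l * same y z) g)))
      where
      image : ∀ z → I z j * same x z ≤ I (app g z) l * same y (app g z)
      image z with lookup (B j) z in z∈?
      ... | false = z≤n
      ... | true with class x ≟ class z
      ...   | no x≁z  = ≤-trans (≤-reflexive (cong (1 *_) (same≡0 x≁z))) z≤n
      ...   | yes x~z = ≤-reflexive (trans (cong (1 *_) (same≡1 x~z)) (sym (cong₂ _*_
        (∈⇒I≡1 (Equivalence.to (g[Bj]≡Bl z) (lookup⇒[]= z (B j) z∈?)))
        (same≡1 (subst (λ t → class t ≡ class (app g z)) gx≡y (class-preserved g g∈G x z x~z))))))

    block-through-zero : ∃[ j ] zero ∈ B j
    block-through-zero with ∃-positive-term (I zero) r>0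
    ... | j , 0<I = j , I>0⇒∈ 0<I

    j₀ : Fin b
    j₀ = proj₁ block-through-zero

    L : ℕ
    L = meet zero j₀

    meet-on-flag : ∀ {x j} → x ∈ B j → meet x j ≡ L
    meet-on-flag x∈Bj = ≤-antisym (meet-mono-flag x∈Bj (proj₂ block-through-zero))
                                  (meet-mono-flag (proj₂ block-through-zero) x∈Bj)

    I*meet : ∀ x j → I x j * meet x j ≡ I x j * L
    I*meet x j with lookup (B j) x in x∈?
    ... | false = refl
    ... | true  = cong (1 *_) (meet-on-flag (lookup⇒[]= x (B j) x∈?))

    class-relation : ∀ x → r * L + lam ≡ r + class-size x * lam
    class-relation x = begin
      r * L + lam                                         ≡⟨ cong (λ t → t * L + lam) (sym (replication-constant x)) ⟩
      replication x * L + lam                             ≡⟨ cong (_+ lam) (*-distribʳ-sum L (I x)) ⟩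
      sum (λ j → I x j * L) + lam                         ≡⟨ cong (_+ lam) (sum-cong-≗ (λ j → sym (I*meet x j))) ⟩
      sum (λ j → I x j * meet x j) + lam                  ≡⟨ cong₂ _+_ (double-count x (same x)) (sym (*-identityˡ lam)) ⟩
      sum (λ y → same x y * common x y) + 1 * lam         ≡⟨ cong (λ t → sum (λ y → same x y * common x y) + t * lam) (sym (same≡1 refl)) ⟩
      sum (λ y → same x y * common x y) + same x x * lam  ≡⟨ weighted-pair-count x (same x) ⟩
      class-size x * lam + same x x * replication x       ≡⟨ cong₂ (λ s t → class-size x * lam + s * t) (same≡1 refl) (replication-constant x) ⟩
      class-size x * lam + 1 * r                          ≡⟨ trans (cong (class-size x * lam +_) (*-identityˡ r)) (+-comm (class-size x * lam) r) ⟩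
      r + class-size x * lam                              ∎
      where open ≡-Reasoning

    c : ℕ
    c = class-size zero

    class-size-constant : ∀ x → class-size x ≡ c
    class-size-constant x = *-cancelʳ-≡ _ _ lam {{>-nonZero lam-pos}}
      (+-cancelˡ-≡ r _ _ (trans (sym (class-relation x)) (class-relation zero)))

    L≥1 : 1 ≤ L
    L≥1 = subst (_≤ L) (cong₂ _*_ (∈⇒I≡1 (proj₂ block-through-zero)) (same≡1 refl))
                (term≤sum (λ y → I y j₀ * same zero y) zero)

    L≤k : L ≤ k
    L≤k = ≤-trans (sum-mono-≤ (λ y → ≤-trans (*-monoʳ-≤ (I y j₀) (𝟙≤1 (does (class zero ≟ class y))))
                                             (≤-reflexive (*-identityʳ (I y j₀)))))
                  (≤-reflexive (block-size j₀))

    2≤c : ∀ {x y} → ¬ x ≡ y → class x ≡ class y → 2 ≤ c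
    2≤c {x} {y} x≢y x~y = subst (2 ≤_) (class-size-constant x)
      (subst₂ (λ s t → s + t ≤ class-size x) (same≡1 refl) (same≡1 x~y) (two-terms≤sum (same x) x≢y))

    c<v : ∀ {x y} → ¬ class x ≡ class y → c < v
    c<v {x} {y} x≁y = subst₂ _<_ (class-size-constant x) (trans (sum-const v 1) (*-identityʳ v))
      (sum-mono-< (λ z → 𝟙≤1 (does (class x ≟ class z))) y (subst (_< 1) (sym (same≡0 x≁y)) z<s))

    IsLeastInClass : Fin v → Set
    IsLeastInClass x = ∀ (i : Fin′ x) → ¬ class (inject i) ≡ class x

    least? : ∀ x → Dec (IsLeastInClass x)
    least? x = all? (λ i → ¬? (class (inject i) ≟ class x))

    least-in-class : ∀ y → ∃[ x ] (IsLeastInClass x × class x ≡ class y)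
    least-in-class y
      with ¬∀⟶∃¬-smallest v (λ z → ¬ class z ≡ class y) (λ z → ¬? (class z ≟ class y)) (λ all → all y refl)
    ... | x , ¬x≁y , below = x , (λ i → subst (λ t → ¬ class (inject i) ≡ t) (sym x~y) (below i)) , x~y
      where
      x~y = decidable-stable (class x ≟ class y) ¬x≁y

    least-unique : ∀ {x x′} → IsLeastInClass x → IsLeastInClass x′ → class x ≡ class x′ → x ≡ x′
    least-unique {x} {x′} least least′ x~x′ with Finₚ.<-cmp x x′
    ... | tri< x<x′ _ _    = ⊥-elim (least′ (fromℕ< x<x′) (trans (cong class (inject-fromℕ< x<x′)) x~x′))
    ... | tri≈ _ x≡x′ _    = x≡x′
    ... | tri> _ _ x′<x    = ⊥-elim (least (fromℕ< x′<x) (trans (cong class (inject-fromℕ< x′<x)) (sym x~x′)))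

    leader : Fin v → ℕ
    leader x = 𝟙 (does (least? x))

    one-leader-per-class : ∀ y → sum (λ x → leader x * same x y) ≡ 1
    one-leader-per-class y with least-in-class y
    ... | x₀ , least₀ , x₀~y = trans (sum-single x₀ others) leader₀
      where
      leader₀ : leader x₀ * same x₀ y ≡ 1
      leader₀ = cong₂ _*_ (cong 𝟙 (dec-true (least? x₀) least₀)) (same≡1 x₀~y)
      others : ∀ x → ¬ x ≡ x₀ → leader x * same x y ≡ 0
      others x x≢x₀ with least? x | class x ≟ class y
      ... | no ¬least | _       = cong (_* same x y) (cong 𝟙 (dec-false (least? x) ¬least))
      ... | yes _     | no x≁y  = trans (cong (leader x *_) (same≡0 x≁y)) (*-zeroʳ (leader x))
      ... | yes least | yes x~y = ⊥-elim (x≢x₀ (least-unique least least₀ (trans x~y (sym x₀~y))))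

    d : ℕ
    d = sum leader

    v≡cd : v ≡ c * d
    v≡cd = begin
      v                                            ≡⟨ sym (trans (sum-const v 1) (*-identityʳ v)) ⟩
      sum {v} (λ _ → 1)                            ≡⟨ sum-cong-≗ (λ y → sym (one-leader-per-class y)) ⟩
      sum (λ y → sum (λ x → leader x * same x y))  ≡⟨ ∑-comm (λ y x → leader x * same x y) ⟩
      sum (λ x → sum (λ y → leader x * same x y))  ≡⟨ sum-cong-≗ (λ x → sym (*-distribˡ-sum (leader x) (same x))) ⟩
      sum (λ x → leader x * class-size x)          ≡⟨ sum-cong-≗ (λ x → cong (leader x *_) (class-size-constant x)) ⟩
      sum (λ x → leader x * c)                     ≡⟨ sym (*-distribʳ-sum c leader) ⟩
      d * c                                        ≡⟨ *-comm d c ⟩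
      c * d                                        ∎
      where open ≡-Reasoning

proposition3p1 : (v k lam b : ℕ) (B : Fin b → Subset v) →
    Is2Design v k lam b B → Nontrivial v k →
    (G : Perm v → Set) → IsAutGroup B G → FlagTransitive B G → PointImprimitive G →
    k ≤ 2 * (lam * lam) * (lam + 1)
proposition3p1 zero          _ _ _ _ _ (_ , ()) _ _ _ _
proposition3p1 (suc zero)    _ _ _ _ _ (s≤s (s≤s (s≤s _)) , s≤s ()) _ _ _ _
proposition3p1 (suc (suc _)) _ lam zero _ design _ _ _ _ _ =
  ⊥-elim (<⇒≢ lam-pos (balanced zero (suc zero) (λ ())))
  where open Is2Design design
proposition3p1 (suc (suc _)) k lam (suc b₁) B design (2<k , k<v) G _ flag-transitive
  (class , (x , y , x≢y , x~y) , (x′ , y′ , x′≁y′) , class-preserved) =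
  imprimitive-bound {b = suc b₁} lam-pos (replication-relation zero) (class-relation zero) bk≡vr v≡cd k≤r
    L≥1 L≤k (2≤c x≢y x~y) (c<v x′≁y′)
  where
  open Is2Design design using (lam-pos)
  open Incidence design 2<k k<v
  open Imprimitivity G flag-transitive class class-preserved
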